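{- Let $G_1=(V_1,E_1)$ and $G_2=(V_2,E_2)$ be finite simple graphs, where $G_i$ has maximum degree $\Delta_i$ and minimum degree $\delta_i$, and let $S\subseteq V_1\times V_2$. Then: (i) If for some $i\in\{1,2\}$ the projection $P_{V_i}(S)$ is a $k_i$-paf set in $G_i$, then for every integer $k\in\{k_i+\Delta_j,\dots,\Delta_i+\Delta_j-2\}$, $S$ is a $k$-paf set in $G_1\times G_2$, where $j\in\{1,2\}$, $j\neq i$. (ii) If for every $i\in\{1,2\}$ the projection $P_{V_i}(S)$ is a $k_i$-paf set in $G_i$, then for every integer $k\in\{k',\dots,\Delta_1+\Delta_2-2\}$, $S$ is a $k$-paf set in $G_1\times G_2$, where $k'=\max\{k_1+k_2-1,\;\min\{k_2-\delta_1,\,k_1-\delta_2\}\}$.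
   Context: For a graph $G=(V,E)$, a set $S\subseteq V$ and $v\in V$, $\delta_S(v)=|\{u\in S: uv\in E\}|$, $\overline{S}=V\setminus S$, and $\partial S$ is the set of vertices of $\overline{S}$ adjacent to at least one vertex of $S$. For an integer $k$, a non-empty set $S\subseteq V$ is a defensive $k$-alliance if $\delta_S(v)\ge \delta_{\overline{S}}(v)+k$ for every $v\in S$, and an offensive $k$-alliance if $\delta_S(v)\ge \delta_{\overline{S}}(v)+k$ for every $v\in\partial S$. A non-empty set is a powerful $k$-alliance if it is both a defensive $k$-alliance and an offensive $(k+2)$-alliance. A set $X\subseteq V$ is powerful $k$-alliance free ($k$-paf) if $X$ contains no powerful $k$-alliance as a subset. The Cartesian product $G_1\times G_2$ has vertex set $V_1\times V_2$, with $(a,b)$ adjacent to $(c,d)$ iff either $a=c$ and $bd\in E_2$, or $b=d$ and $ac\in E_1$. For $A\subseteq V_1\times V_2$, $P_{V_i}(A)$ denotes the projection of $A$ onto $V_i$. -}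

module Defs where

open import Data.Bool using (Bool; true; false; _∧_; _∨_; not)
open import Data.Nat as ℕ using (ℕ)
open import Data.Integer as ℤ using (ℤ; +_; _≤_; _⊔_; _⊓_)
open import Data.Fin as Fin using (Fin; combine; remQuot)
open import Data.Fin.Subset using (Subset; _∈_; _∉_; _⊆_; _∩_; ∁; ∣_∣; Nonempty)
open import Data.Vec using (tabulate; lookup)
open import Data.List using (allFin)
open import Data.Bool.ListAction using (any)
open import Data.Product using (Σ; ∃; _×_; _,_; proj₁; proj₂)
open import Relation.Nullary using (¬_; does)
open import Relation.Binary.PropositionalEquality using (_≡_)

Adj : ℕ → Set
Adj n = Fin n → Fin n → Bool

record SimpleGraph : Set where
  field
    n      : ℕ
    adj    : Adj n
    sym    : ∀ u v → adj u v ≡ adj v u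
    irrefl : ∀ v → adj v v ≡ false
open SimpleGraph public

nbhd : ∀ {n} → Adj n → Fin n → Subset n
nbhd A v = tabulate (A v)

degIn : ∀ {n} → Adj n → Subset n → Fin n → ℕ
degIn A S v = ∣ S ∩ nbhd A v ∣

deg : ∀ {n} → Adj n → Fin n → ℕ
deg A v = ∣ nbhd A v ∣

IsMaxDegree : SimpleGraph → ℕ → Set
IsMaxDegree G Δ = (∀ v → deg (adj G) v ℕ.≤ Δ) × (∃ λ v → deg (adj G) v ≡ Δ)

IsMinDegree : SimpleGraph → ℕ → Set
IsMinDegree G δ = (∀ v → δ ℕ.≤ deg (adj G) v) × (∃ λ v → deg (adj G) v ≡ δ)

InBoundary : ∀ {n} → Adj n → Subset n → Fin n → Set
InBoundary A S v = v ∉ S × (∃ λ u → u ∈ S × A u v ≡ true)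

DefensiveAlliance : ∀ {n} → Adj n → ℤ → Subset n → Set
DefensiveAlliance A k S =
  Nonempty S × (∀ v → v ∈ S → + degIn A (∁ S) v ℤ.+ k ≤ + degIn A S v)

OffensiveAlliance : ∀ {n} → Adj n → ℤ → Subset n → Set
OffensiveAlliance A k S =
  Nonempty S × (∀ v → InBoundary A S v → + degIn A (∁ S) v ℤ.+ k ≤ + degIn A S v)

PowerfulAlliance : ∀ {n} → Adj n → ℤ → Subset n → Set
PowerfulAlliance A k S = DefensiveAlliance A k S × OffensiveAlliance A (k ℤ.+ + 2) S

PAF : ∀ {n} → Adj n → ℤ → Subset n → Set
PAF A k X = ∀ Y → Y ⊆ X → ¬ PowerfulAlliance A k Y

-- Cartesian product G₁ × G₂, vertex (a , b) encoded as combine a b : Fin (n₁ * n₂)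
prodAdj : (G₁ G₂ : SimpleGraph) → Adj (n G₁ ℕ.* n G₂)
prodAdj G₁ G₂ x y =
  (does (a Fin.≟ c) ∧ adj G₂ b d) ∨ (does (b Fin.≟ d) ∧ adj G₁ a c)
  where
    a = proj₁ (remQuot {n G₁} (n G₂) x)
    b = proj₂ (remQuot {n G₁} (n G₂) x)
    c = proj₁ (remQuot {n G₁} (n G₂) y)
    d = proj₂ (remQuot {n G₁} (n G₂) y)

proj₁S : (G₁ G₂ : SimpleGraph) → Subset (n G₁ ℕ.* n G₂) → Subset (n G₁)
proj₁S G₁ G₂ S = tabulate λ a → any (λ b → lookup S (combine a b)) (allFin (n G₂))

proj₂S : (G₁ G₂ : SimpleGraph) → Subset (n G₁ ℕ.* n G₂) → Subset (n G₂)
proj₂S G₁ G₂ S = tabulate λ b → any (λ a → lookup S (combine a b)) (allFin (n G₁))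

module Submission where

-- Write a set Y ⊆ V₁ × V₂ through its coordinates, with fibre
-- Y_a = {d : (a , d) ∈ Y} over a ∈ V₁ and column Yᵇ = {c : (c , b) ∈ Y}.
-- The neighbours of (a , b) in G₁ × G₂ are its row neighbours (a , d), d ∼ b,
-- and its column neighbours (c , b), c ∼ a, so
--     δ_Y(a , b) = δ_{Y_a}(b) + δ_{Yᵇ}(a)      (and likewise for the complement).
-- Every column Yᵇ lies in the projection X = P_{V₁}(Y), so an alliance
-- inequality at (a , b) transfers to X at a, up to a bounded loss in the row
-- part; when instead X fails at a, it transfers to the fibre Y_a.  Hence for
-- a powerful k-alliance Y of G₁ × G₂:
--   (I)  X is a powerful k₁-alliance of G₁ whenever k₁ + Δ₂ ≤ k;
--   (II) if k₁ - δ₂ ≤ k, k₁ + k₂ - 1 ≤ k and P_{V₂}(Y) is k₂-paf in G₂, then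
--        X is a powerful k₁-alliance of G₁ (a failure of X at a would make
--        the fibre Y_a ⊆ P_{V₂}(Y) a powerful k₂-alliance of G₂).
-- A powerful alliance Y ⊆ S thus yields one inside P_{V₁}(S) (or P_{V₂}(S)
-- after exchanging the factors), against the paf hypotheses.

open import Defs hiding (sym)
open import Algebra.Properties.CommutativeMonoid.Sum as Sum using ()
open import Data.Bool using (Bool; true; false; _∧_; _∨_; not; T)
open import Data.Bool.Properties using (∧-zeroʳ; ∨-zeroʳ; T-≡; ¬-not; not-¬)
open import Data.Bool.ListAction using (any)
open import Data.Empty using (⊥-elim)
open import Data.Fin as Fin using (Fin; zero; suc; combine; remQuot; _↑ˡ_; _↑ʳ_; punchIn)
open import Data.Fin.Properties using (remQuot-combine; combine-remQuot; punchInᵢ≢i)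
open import Data.Fin.Subset using (Subset; _∈_; _∉_; _⊆_; _∩_; ∁; ∣_∣; Nonempty; ⊥)
open import Data.Fin.Subset.Properties
  using (p⊆q⇒∣p∣≤∣q∣; p∩q⊆q; x∈p∩q⁺; x∈p∩q⁻; x∉p⇒x∈∁p; p⊆q⇒∁p⊇∁q; ∣⊥∣≡0)
open import Data.Integer as ℤ using (ℤ; +_; _≤_; _<_; _⊔_; _⊓_; _-_; 0ℤ; +≤+)
import Data.Integer.Properties as ℤP
open import Data.Integer.Tactic.RingSolver using (solve-∀)
open import Data.List using (allFin)
open import Data.List.Membership.Propositional.Properties using (∈-allFin)
open import Data.List.Relation.Unary.Any as Any using ()
open import Data.List.Relation.Unary.Any.Properties using (any⁺; any⁻)
open import Data.Nat as ℕ using (ℕ)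
import Data.Nat.Properties as ℕP
open import Data.Product using (∃; _×_; _,_; proj₁; proj₂)
open import Data.Sum using (_⊎_; inj₁; inj₂)
open import Data.Vec using ([]; _∷_; tabulate; lookup)
open import Data.Vec.Properties using ([]=⇒lookup; lookup⇒[]=; lookup∘tabulate; lookup-map; tabulate-cong; tabulate-∘)
open import Function using (_∘_; flip; Equivalence)
open import Relation.Binary.PropositionalEquality
open import Relation.Nullary using (does; yes; no)
open import Relation.Nullary.Decidable using (dec-true; dec-false)

open Sum ℕP.+-0-commutativeMonoid using (sum; sum-cong-≗; sum-remove; sum-replicate-zero; ∑-distrib-+)
open Equivalence using (to; from)

indicator : Bool → ℕ
indicator true  = 1
indicator false = 0

count : ∀ {m} → (Fin m → Bool) → ℕ
count f = sum (λ i → indicator (f i))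

count-cong : ∀ {m} {f g : Fin m → Bool} → (∀ i → f i ≡ g i) → count f ≡ count g
count-cong f≗g = sum-cong-≗ (cong indicator ∘ f≗g)

∣∩tabulate∣ : ∀ {m} (S : Subset m) (g : Fin m → Bool) →
              ∣ S ∩ tabulate g ∣ ≡ count (λ u → lookup S u ∧ g u)
∣∩tabulate∣ []      g = refl
∣∩tabulate∣ (x ∷ S) g with x ∧ g zero | ∣∩tabulate∣ S (g ∘ suc)
... | true  | e = cong ℕ.suc e
... | false | e = e

sum-↑ : ∀ m {n} (h : Fin (m ℕ.+ n) → ℕ) →
        sum h ≡ sum (λ i → h (i ↑ˡ n)) ℕ.+ sum (λ j → h (m ↑ʳ j))
sum-↑ ℕ.zero    h = refl
sum-↑ (ℕ.suc m) h = trans (cong (h zero ℕ.+_) (sum-↑ m (h ∘ suc))) (sym (ℕP.+-assoc (h zero) _ _))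

sum-combine : ∀ m {n} (h : Fin (m ℕ.* n) → ℕ) →
              sum h ≡ sum (λ c → sum (λ d → h (combine {m} {n} c d)))
sum-combine ℕ.zero    h = refl
sum-combine (ℕ.suc m) {n} h =
  trans (sum-↑ n {m ℕ.* n} h) (cong (sum (λ d → h (combine {ℕ.suc m} {n} zero d)) ℕ.+_) (sum-combine m (λ i → h (n ↑ʳ i))))

sum-at : ∀ {m} (h : Fin m → ℕ) (a : Fin m) → (∀ c → c ≢ a → h c ≡ 0) → sum h ≡ h a
sum-at {ℕ.suc m} h a vanish = begin
  sum h                                  ≡⟨ sum-remove {i = a} h ⟩
  h a ℕ.+ sum (λ j → h (punchIn a j))    ≡⟨ cong (h a ℕ.+_) rest-vanishes ⟩
  h a ℕ.+ 0                              ≡⟨ ℕP.+-identityʳ (h a) ⟩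
  h a                                    ∎
  where
  open ≡-Reasoning
  rest-vanishes : sum (λ j → h (punchIn a j)) ≡ 0
  rest-vanishes = trans (sum-cong-≗ (λ j → vanish (punchIn a j) (punchInᵢ≢i a j))) (sum-replicate-zero m)

closed-gate : ∀ {e} x → e ≡ false → indicator (e ∧ x) ≡ 0
closed-gate x refl = refl

open-gate : ∀ {e} x → e ≡ true → indicator (e ∧ x) ≡ indicator x
open-gate x refl = refl

prodAdj-combine : ∀ G₁ G₂ (a c : Fin (n G₁)) (b d : Fin (n G₂)) →
  prodAdj G₁ G₂ (combine a b) (combine c d) ≡ (does (a Fin.≟ c) ∧ adj G₂ b d) ∨ (does (b Fin.≟ d) ∧ adj G₁ a c)
prodAdj-combine G₁ G₂ a c b d =
  cong₂ onCoordinates (remQuot-combine {n G₁} {n G₂} a b) (remQuot-combine {n G₁} {n G₂} c d)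
  where
  onCoordinates : Fin (n G₁) × Fin (n G₂) → Fin (n G₁) × Fin (n G₂) → Bool
  onCoordinates (a , b) (c , d) = (does (a Fin.≟ c) ∧ adj G₂ b d) ∨ (does (b Fin.≟ d) ∧ adj G₁ a c)

row-edge : ∀ G₁ G₂ a {b d} → adj G₂ d b ≡ true → prodAdj G₁ G₂ (combine a d) (combine a b) ≡ true
row-edge G₁ G₂ a {b} {d} d∼b
  rewrite prodAdj-combine G₁ G₂ a a d b | dec-true (a Fin.≟ a) refl | d∼b = refl

column-edge : ∀ G₁ G₂ b {a c} → adj G₁ c a ≡ true → prodAdj G₁ G₂ (combine c b) (combine a b) ≡ true
column-edge G₁ G₂ b {a} {c} c∼a
  rewrite prodAdj-combine G₁ G₂ c a b b | dec-true (b Fin.≟ b) refl | c∼a = ∨-zeroʳ _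

-- Row edges and column edges of the product are never both present, since
-- that would need a loop b ∼ b in G₂.
row-column-exclusive : ∀ G₁ G₂ (a c : Fin (n G₁)) (b d : Fin (n G₂)) →
  (does (a Fin.≟ c) ∧ adj G₂ b d) ∧ (does (b Fin.≟ d) ∧ adj G₁ a c) ≡ false
row-column-exclusive G₁ G₂ a c b d with a Fin.≟ c | b Fin.≟ d
... | no _     | _        = refl
... | yes _    | no _     = ∧-zeroʳ (adj G₂ b d)
... | yes refl | yes refl rewrite irrefl G₂ b = refl

indicator-split : ∀ p e₁ x e₂ y → (e₁ ∧ x) ∧ (e₂ ∧ y) ≡ false →
  indicator (p ∧ ((e₁ ∧ x) ∨ (e₂ ∧ y))) ≡ indicator (e₁ ∧ (p ∧ x)) ℕ.+ indicator (e₂ ∧ (p ∧ y))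
indicator-split false false x false y _ = refl
indicator-split false false x true  y _ = refl
indicator-split false true  x false y _ = refl
indicator-split false true  x true  y _ = refl
indicator-split true  false x e₂    y _ = refl
indicator-split true  true  false e₂ y _ = refl
indicator-split true  true  true false y _ = refl
indicator-split true  true  true true false _ = refl
indicator-split true  true  true true true ()

count-prod : ∀ G₁ G₂ (P : Fin (n G₁ ℕ.* n G₂) → Bool) a b →
  count (λ x → P x ∧ prodAdj G₁ G₂ (combine a b) x)
    ≡ count (λ d → P (combine a d) ∧ adj G₂ b d) ℕ.+ count (λ c → P (combine c b) ∧ adj G₁ a c)
count-prod G₁ G₂ P a b = begin
  count (λ x → P x ∧ prodAdj G₁ G₂ (combine a b) x)
    ≡⟨ sum-combine (n G₁) {n G₂} _ ⟩
  sum₁ (λ c → sum₂ (λ d → indicator (P (combine c d) ∧ prodAdj G₁ G₂ (combine a b) (combine c d))))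
    ≡⟨ sum-cong-≗ (λ c → sum-cong-≗ (λ d → split c d)) ⟩
  sum₁ (λ c → sum₂ (λ d → inRow c d ℕ.+ inColumn c d))
    ≡⟨ sum-cong-≗ (λ c → ∑-distrib-+ (inRow c) (inColumn c)) ⟩
  sum₁ (λ c → sum₂ (inRow c) ℕ.+ sum₂ (inColumn c))
    ≡⟨ ∑-distrib-+ (λ c → sum₂ (inRow c)) (λ c → sum₂ (inColumn c)) ⟩
  sum₁ (λ c → sum₂ (inRow c)) ℕ.+ sum₁ (λ c → sum₂ (inColumn c))
    ≡⟨ cong₂ ℕ._+_ only-row-a only-column-b ⟩
  count (λ d → P (combine a d) ∧ adj G₂ b d) ℕ.+ count (λ c → P (combine c b) ∧ adj G₁ a c)
    ∎
  where
  open ≡-Reasoning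
  sum₁ : (Fin (n G₁) → ℕ) → ℕ
  sum₁ = sum
  sum₂ : (Fin (n G₂) → ℕ) → ℕ
  sum₂ = sum
  inRow inColumn : Fin (n G₁) → Fin (n G₂) → ℕ
  inRow    c d = indicator (does (a Fin.≟ c) ∧ (P (combine c d) ∧ adj G₂ b d))
  inColumn c d = indicator (does (b Fin.≟ d) ∧ (P (combine c d) ∧ adj G₁ a c))

  split : ∀ c d → indicator (P (combine c d) ∧ prodAdj G₁ G₂ (combine a b) (combine c d)) ≡ inRow c d ℕ.+ inColumn c d
  split c d = trans (cong (λ z → indicator (P (combine c d) ∧ z)) (prodAdj-combine G₁ G₂ a c b d))
                    (indicator-split (P (combine c d)) (does (a Fin.≟ c)) (adj G₂ b d) (does (b Fin.≟ d)) (adj G₁ a c)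
                                     (row-column-exclusive G₁ G₂ a c b d))

  only-row-a : sum₁ (λ c → sum₂ (inRow c)) ≡ count (λ d → P (combine a d) ∧ adj G₂ b d)
  only-row-a = trans (sum-at (λ c → sum₂ (inRow c)) a off-row)
                     (sum-cong-≗ (λ d → open-gate (P (combine a d) ∧ adj G₂ b d) (dec-true (a Fin.≟ a) refl)))
    where
    off-row : ∀ c → c ≢ a → sum₂ (inRow c) ≡ 0
    off-row c c≢a = trans (sum-cong-≗ (λ d → closed-gate (P (combine c d) ∧ adj G₂ b d) (dec-false (a Fin.≟ c) (c≢a ∘ sym))))
                          (sum-replicate-zero (n G₂))

  only-column-b : sum₁ (λ c → sum₂ (inColumn c)) ≡ count (λ c → P (combine c b) ∧ adj G₁ a c)
  only-column-b = sum-cong-≗ (λ c → trans (sum-at (inColumn c) b (off-column c))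
                                           (open-gate (P (combine c b) ∧ adj G₁ a c) (dec-true (b Fin.≟ b) refl)))
    where
    off-column : ∀ c d → d ≢ b → inColumn c d ≡ 0
    off-column c d d≢b = closed-gate (P (combine c d) ∧ adj G₁ a c) (dec-false (b Fin.≟ d) (d≢b ∘ sym))

∈⇒true : ∀ {m} {S : Subset m} {x} → x ∈ S → lookup S x ≡ true
∈⇒true = []=⇒lookup

true⇒∈ : ∀ {m} {S : Subset m} {x} → lookup S x ≡ true → x ∈ S
true⇒∈ {S = S} {x} = lookup⇒[]= x S

∈-tabulate⁺ : ∀ {m} {f : Fin m → Bool} {x} → f x ≡ true → x ∈ tabulate f
∈-tabulate⁺ {f = f} {x} fx = true⇒∈ (trans (lookup∘tabulate f x) fx)

∈-tabulate⁻ : ∀ {m} {f : Fin m → Bool} {x} → x ∈ tabulate f → f x ≡ true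
∈-tabulate⁻ {f = f} {x} x∈ = trans (sym (lookup∘tabulate f x)) (∈⇒true x∈)

degIn-tabulate : ∀ {m} (A : Adj m) (f : Fin m → Bool) v → degIn A (tabulate f) v ≡ count (λ u → f u ∧ A v u)
degIn-tabulate A f v =
  trans (∣∩tabulate∣ (tabulate f) (A v)) (count-cong (λ u → cong (_∧ A v u) (lookup∘tabulate f u)))

degIn-mono : ∀ {m} (A : Adj m) {S T : Subset m} v → S ⊆ T → degIn A S v ℕ.≤ degIn A T v
degIn-mono A {S} v S⊆T = p⊆q⇒∣p∣≤∣q∣ λ x∈ →
  let (x∈S , x∈N) = x∈p∩q⁻ S (nbhd A v) x∈ in x∈p∩q⁺ (S⊆T x∈S , x∈N)

degIn≤deg : ∀ {m} (A : Adj m) (S : Subset m) v → degIn A S v ℕ.≤ deg A v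
degIn≤deg A S v = p⊆q⇒∣p∣≤∣q∣ (p∩q⊆q S (nbhd A v))

degIn-empty : ∀ {m} (A : Adj m) {S : Subset m} v → (∀ u → u ∉ S) → degIn A S v ≡ 0
degIn-empty {m} A {S} v empty =
  ℕP.n≤0⇒n≡0 (subst (degIn A S v ℕ.≤_) (∣⊥∣≡0 m)
    (p⊆q⇒∣p∣≤∣q∣ {q = ⊥} λ x∈ → ⊥-elim (empty _ (proj₁ (x∈p∩q⁻ S _ x∈)))))

deg≤degIn-∁-empty : ∀ {m} (A : Adj m) {S : Subset m} v → (∀ u → u ∉ S) → deg A v ℕ.≤ degIn A (∁ S) v
deg≤degIn-∁-empty A v empty = p⊆q⇒∣p∣≤∣q∣ λ x∈N → x∈p∩q⁺ (x∉p⇒x∈∁p (empty _) , x∈N)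

BoolRel : ℕ → ℕ → Set
BoolRel m k = Fin m → Fin k → Bool

coords : ∀ G₁ G₂ → Subset (n G₁ ℕ.* n G₂) → BoolRel (n G₁) (n G₂)
coords G₁ G₂ Y a b = lookup Y (combine a b)

fibre : ∀ {m k} → BoolRel m k → Fin m → Subset k
fibre R a = tabulate (R a)

column : ∀ {m k} → BoolRel m k → Fin k → Subset m
column R = fibre (flip R)

tabulate-∁ : ∀ {m k} (Y : Subset m) (f : Fin k → Fin m) →
             tabulate (λ i → lookup (∁ Y) (f i)) ≡ ∁ (tabulate (λ i → lookup Y (f i)))
tabulate-∁ Y f = trans (tabulate-cong (λ i → lookup-map (f i) not Y)) (tabulate-∘ not (λ i → lookup Y (f i)))

degIn-prod : ∀ G₁ G₂ (Y : Subset (n G₁ ℕ.* n G₂)) a b →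
  degIn (prodAdj G₁ G₂) Y (combine a b)
    ≡ degIn (adj G₂) (fibre (coords G₁ G₂ Y) a) b ℕ.+ degIn (adj G₁) (column (coords G₁ G₂ Y) b) a
degIn-prod G₁ G₂ Y a b = begin
  degIn (prodAdj G₁ G₂) Y (combine a b)
    ≡⟨ ∣∩tabulate∣ Y (prodAdj G₁ G₂ (combine a b)) ⟩
  count (λ x → lookup Y x ∧ prodAdj G₁ G₂ (combine a b) x)
    ≡⟨ count-prod G₁ G₂ (lookup Y) a b ⟩
  count (λ d → coords G₁ G₂ Y a d ∧ adj G₂ b d) ℕ.+ count (λ c → coords G₁ G₂ Y c b ∧ adj G₁ a c)
    ≡⟨ sym (cong₂ ℕ._+_ (degIn-tabulate (adj G₂) (coords G₁ G₂ Y a) b)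
                        (degIn-tabulate (adj G₁) (λ c → coords G₁ G₂ Y c b) a)) ⟩
  degIn (adj G₂) (fibre (coords G₁ G₂ Y) a) b ℕ.+ degIn (adj G₁) (column (coords G₁ G₂ Y) b) a
    ∎
  where open ≡-Reasoning

degIn-prod-∁ : ∀ G₁ G₂ (Y : Subset (n G₁ ℕ.* n G₂)) a b →
  degIn (prodAdj G₁ G₂) (∁ Y) (combine a b)
    ≡ degIn (adj G₂) (∁ (fibre (coords G₁ G₂ Y) a)) b ℕ.+ degIn (adj G₁) (∁ (column (coords G₁ G₂ Y) b)) a
degIn-prod-∁ G₁ G₂ Y a b =
  trans (degIn-prod G₁ G₂ (∁ Y) a b)
        (cong₂ (λ F C → degIn (adj G₂) F b ℕ.+ degIn (adj G₁) C a)
               (tabulate-∁ Y (combine a)) (tabulate-∁ Y (λ c → combine c b)))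

projection : ∀ {m k} → BoolRel m k → Subset m
projection {k = k} R = tabulate (λ a → any (R a) (allFin k))

∈-projection⁺ : ∀ {m k} (R : BoolRel m k) {a b} → R a b ≡ true → a ∈ projection R
∈-projection⁺ R {a} {b} aRb =
  ∈-tabulate⁺ (to T-≡ (any⁺ (R a) (Any.map (λ b≡d → subst (T ∘ R a) b≡d (from T-≡ aRb)) (∈-allFin b))))

∈-projection⁻ : ∀ {m k} (R : BoolRel m k) {a} → a ∈ projection R → ∃ λ b → R a b ≡ true
∈-projection⁻ {k = k} R {a} a∈ =
  let (b , Tb) = Any.satisfied (any⁻ (R a) (allFin k) (from T-≡ (∈-tabulate⁻ a∈))) in b , to T-≡ Tb

column⊆projection : ∀ {m k} (R : BoolRel m k) b → column R b ⊆ projection R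
column⊆projection R b c∈ = ∈-projection⁺ R (∈-tabulate⁻ c∈)

projection-mono : ∀ {m k} {R R′ : BoolRel m k} → (∀ a b → R a b ≡ true → R′ a b ≡ true) → projection R ⊆ projection R′
projection-mono {R = R} {R′} R⊆R′ a∈ = let (b , aRb) = ∈-projection⁻ R a∈ in ∈-projection⁺ R′ (R⊆R′ _ b aRb)

≤-by-difference : ∀ {a b x y : ℤ} → a ≤ b → y - x ≡ b - a → x ≤ y
≤-by-difference a≤b eq = ℤP.0≤i-j⇒j≤i (subst (0ℤ ≤_) (sym eq) (ℤP.i≤j⇒0≤j-i a≤b))

keep-second : ∀ {x x′ y y′ K K′ e : ℤ} →
              x′ ℤ.+ y′ ℤ.+ K ≤ x ℤ.+ y → x ≤ x′ ℤ.+ e → K′ ℤ.+ e ≤ K → y′ ℤ.+ K′ ≤ y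
keep-second {x} {x′} {y} {y′} {K} {K′} {e} h x-gain hK =
  ≤-by-difference (ℤP.+-mono-≤ (ℤP.+-mono-≤ h x-gain) hK) (certificate x x′ y y′ K K′ e)
  where
  certificate : ∀ x x′ y y′ K K′ e →
    y - (y′ ℤ.+ K′) ≡ (x ℤ.+ y ℤ.+ (x′ ℤ.+ e) ℤ.+ K) - (x′ ℤ.+ y′ ℤ.+ K ℤ.+ x ℤ.+ (K′ ℤ.+ e))
  certificate = solve-∀

keep-first : ∀ {x x′ y y′ K K′ e : ℤ} →
             x′ ℤ.+ y′ ℤ.+ K ≤ x ℤ.+ y → y ≤ y′ ℤ.+ e → K′ ℤ.+ e ≤ K → x′ ℤ.+ K′ ≤ x
keep-first {x} {x′} {y} {y′} {K} {K′} {e} h y-gain hK =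
  ≤-by-difference (ℤP.+-mono-≤ (ℤP.+-mono-≤ h y-gain) hK) (certificate x x′ y y′ K K′ e)
  where
  certificate : ∀ x x′ y y′ K K′ e →
    x - (x′ ℤ.+ K′) ≡ (x ℤ.+ y ℤ.+ (y′ ℤ.+ e) ℤ.+ K) - (x′ ℤ.+ y′ ℤ.+ K ℤ.+ y ℤ.+ (K′ ℤ.+ e))
  certificate = solve-∀

<⇒≤-pred : ∀ {i j k : ℤ} → i < j ℤ.+ k → i ≤ j ℤ.+ (k - + 1)
<⇒≤-pred {i} {j} {k} i<j+k = ≤-by-difference (ℤP.i<j⇒suc[i]≤j i<j+k) (certificate i j k)
  where
  certificate : ∀ i j k → j ℤ.+ (k - + 1) - i ≡ j ℤ.+ k - (+ 1 ℤ.+ i)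
  certificate = solve-∀

-- Offensive thresholds are defensive ones raised by 2.
raise-threshold : ∀ (K′ e : ℤ) {K : ℤ} → K′ ℤ.+ e ≤ K → (K′ ℤ.+ + 2) ℤ.+ e ≤ K ℤ.+ + 2
raise-threshold K′ e {K} h = ≤-by-difference h (certificate K′ e K)
  where
  certificate : ∀ K′ e K → K ℤ.+ + 2 - ((K′ ℤ.+ + 2) ℤ.+ e) ≡ K - (K′ ℤ.+ e)
  certificate = solve-∀

-- The hypothesis k₁ + k₂ - 1 ≤ k of Part II, in the form used for fibres.
fibre-threshold : ∀ (k₁ k₂ : ℤ) {k : ℤ} → k₁ ℤ.+ k₂ - + 1 ≤ k → k₂ ℤ.+ (k₁ - + 1) ≤ k
fibre-threshold k₁ k₂ {k} h = ≤-by-difference h (certificate k₁ k₂ k)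
  where
  certificate : ∀ k₁ k₂ k → k - (k₂ ℤ.+ (k₁ - + 1)) ≡ k - (k₁ ℤ.+ k₂ - + 1)
  certificate = solve-∀

-- Throughout, R is a set of V₁ × V₂ given in coordinates (Y read by coords).
module Coordinates (G₁ G₂ : SimpleGraph) (R : BoolRel (n G₁) (n G₂)) where

  inRow outRow inColumn outColumn : Fin (n G₁) → Fin (n G₂) → ℕ
  inRow     a b = degIn (adj G₂) (fibre R a) b
  outRow    a b = degIn (adj G₂) (∁ (fibre R a)) b
  inColumn  a b = degIn (adj G₁) (column R b) a
  outColumn a b = degIn (adj G₁) (∁ (column R b)) a

  ProductInequality : ℤ → Fin (n G₁) → Fin (n G₂) → Set
  ProductInequality K a b = + (outRow a b ℕ.+ outColumn a b) ℤ.+ K ≤ + (inRow a b ℕ.+ inColumn a b)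

  Attacked : Fin (n G₁) → Fin (n G₂) → Set
  Attacked a b = (∃ λ d → R a d ≡ true × adj G₂ d b ≡ true) ⊎ (∃ λ c → R c b ≡ true × adj G₁ c a ≡ true)

  record ProductAlliance (k : ℤ) : Set where
    field
      nonempty  : ∃ λ a → ∃ λ b → R a b ≡ true
      defensive : ∀ a b → R a b ≡ true → ProductInequality k a b
      offensive : ∀ a b → R a b ≡ false → Attacked a b → ProductInequality (k ℤ.+ + 2) a b

  X : Subset (n G₁)
  X = projection R

  -- Column transfer: the inequality at (a , b) yields the alliance
  -- inequality of X at a, losing what the row part gains.
  column-transfer : ∀ {K a b} (K′ e : ℤ) → ProductInequality K a b → + inRow a b ≤ + outRow a b ℤ.+ e → K′ ℤ.+ e ≤ K →
                    + degIn (adj G₁) (∁ X) a ℤ.+ K′ ≤ + degIn (adj G₁) X a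
  column-transfer {K} {a} {b} K′ e ineq row-gain hK =
    ℤP.≤-trans (ℤP.+-monoˡ-≤ K′ (+≤+ (degIn-mono (adj G₁) a (p⊆q⇒∁p⊇∁q (column⊆projection R b)))))
               (ℤP.≤-trans (keep-second {+ inRow a b} {+ outRow a b} {+ inColumn a b} {+ outColumn a b} {K} {K′} {e}
                                         ineq row-gain hK)
                           (+≤+ (degIn-mono (adj G₁) a (column⊆projection R b))))

  -- Row transfer: if X violates its k₁-inequality at a, the column part of
  -- the inequality at (a , b) gains at most k₁ - 1, and the fibre R_a
  -- inherits the inequality at b.
  row-transfer : ∀ {K a b} (K′ k₁ : ℤ) → ProductInequality K a b →
                 + degIn (adj G₁) X a < + degIn (adj G₁) (∁ X) a ℤ.+ k₁ → K′ ℤ.+ (k₁ - + 1) ≤ K →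
                 + outRow a b ℤ.+ K′ ≤ + inRow a b
  row-transfer {K} {a} {b} K′ k₁ ineq X-fails hK =
    keep-first {+ inRow a b} {+ outRow a b} {+ inColumn a b} {+ outColumn a b} {K} {K′} {k₁ - + 1} ineq column-gain hK
    where
    column-gain : + inColumn a b ≤ + outColumn a b ℤ.+ (k₁ - + 1)
    column-gain =
      ℤP.≤-trans (+≤+ (degIn-mono (adj G₁) a (column⊆projection R b)))
        (ℤP.≤-trans (<⇒≤-pred {j = + degIn (adj G₁) (∁ X) a} {k₁} X-fails)
          (ℤP.+-monoˡ-≤ (k₁ - + 1) (+≤+ (degIn-mono (adj G₁) a (p⊆q⇒∁p⊇∁q (column⊆projection R b))))))

  module _ {k : ℤ} (Y : ProductAlliance k) where
    open ProductAlliance Y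

    projection-nonempty : Nonempty X
    projection-nonempty = let (a , b , aRb) = nonempty in a , ∈-projection⁺ R aRb

    -- Offensive part of both (I) and (II): a boundary vertex a of X has an
    -- empty fibre, so at (a , b) the row part gains at most -δ₂.
    projection-offensive : ∀ {k₁} (δ₂ : ℕ) → (∀ b → δ₂ ℕ.≤ deg (adj G₂) b) → k₁ - + δ₂ ≤ k →
      ∀ a → InBoundary (adj G₁) X a → + degIn (adj G₁) (∁ X) a ℤ.+ (k₁ ℤ.+ + 2) ≤ + degIn (adj G₁) X a
    projection-offensive {k₁} δ₂ mindeg hk a (a∉X , c , c∈X , c∼a) =
      column-transfer (k₁ ℤ.+ + 2) (ℤ.- (+ δ₂)) (offensive a b aRb-false (inj₂ (c , cRb , c∼a))) row-gain
                      (raise-threshold k₁ (ℤ.- (+ δ₂)) hk)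
      where
      b : Fin (n G₂)
      b = proj₁ (∈-projection⁻ R c∈X)
      cRb : R c b ≡ true
      cRb = proj₂ (∈-projection⁻ R c∈X)
      fibre-empty : ∀ d → d ∉ fibre R a
      fibre-empty d d∈ = a∉X (∈-projection⁺ R (∈-tabulate⁻ d∈))
      aRb-false : R a b ≡ false
      aRb-false = ¬-not λ aRb → fibre-empty b (∈-tabulate⁺ aRb)
      row-gain : + inRow a b ≤ + outRow a b - + δ₂
      row-gain = subst (λ r → + r ≤ + outRow a b - + δ₂) (sym (degIn-empty (adj G₂) b fibre-empty))
                       (ℤP.i≤j⇒0≤j-i (+≤+ (ℕP.≤-trans (mindeg b) (deg≤degIn-∁-empty (adj G₂) b fibre-empty))))

    projection-powerful : ∀ (k₁ : ℤ) (Δ₂ : ℕ) → (∀ b → deg (adj G₂) b ℕ.≤ Δ₂) → k₁ ℤ.+ + Δ₂ ≤ k →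
                          PowerfulAlliance (adj G₁) k₁ X
    projection-powerful k₁ Δ₂ maxdeg hk =
      (projection-nonempty , X-defensive) , (projection-nonempty , projection-offensive {k₁} 0 (λ _ → ℕ.z≤n) k₁≤k)
      where
      X-defensive : ∀ a → a ∈ X → + degIn (adj G₁) (∁ X) a ℤ.+ k₁ ≤ + degIn (adj G₁) X a
      X-defensive a a∈X =
        let (b , aRb) = ∈-projection⁻ R a∈X
        in column-transfer k₁ (+ Δ₂) (defensive a b aRb)
             (+≤+ (ℕP.m≤n⇒m≤o+n (outRow a b) (ℕP.≤-trans (degIn≤deg (adj G₂) (fibre R a) b) (maxdeg b)))) hk
      k₁≤k : k₁ - + 0 ≤ k
      k₁≤k = subst (_≤ k) (sym (ℤP.+-identityʳ k₁)) (ℤP.≤-trans (ℤP.i≤i+j k₁ (+ Δ₂)) hk)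

    fibre-powerful : ∀ {k₁ k₂ a b₀} → R a b₀ ≡ true →
                     + degIn (adj G₁) X a < + degIn (adj G₁) (∁ X) a ℤ.+ k₁ → k₁ ℤ.+ k₂ - + 1 ≤ k →
                     PowerfulAlliance (adj G₂) k₂ (fibre R a)
    fibre-powerful {k₁} {k₂} {a} {b₀} aRb₀ X-fails hk =
      (fibre-nonempty , fibre-defensive) , (fibre-nonempty , fibre-offensive)
      where
      fibre-nonempty : Nonempty (fibre R a)
      fibre-nonempty = b₀ , ∈-tabulate⁺ aRb₀
      fibre-defensive : ∀ b → b ∈ fibre R a → + outRow a b ℤ.+ k₂ ≤ + inRow a b
      fibre-defensive b b∈ = row-transfer k₂ k₁ (defensive a b (∈-tabulate⁻ b∈)) X-fails (fibre-threshold k₁ k₂ hk)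
      fibre-offensive : ∀ d → InBoundary (adj G₂) (fibre R a) d → + outRow a d ℤ.+ (k₂ ℤ.+ + 2) ≤ + inRow a d
      fibre-offensive d (d∉ , b , b∈ , b∼d) =
        row-transfer (k₂ ℤ.+ + 2) k₁ (offensive a d (¬-not λ aRd → d∉ (∈-tabulate⁺ aRd)) (inj₁ (b , ∈-tabulate⁻ b∈ , b∼d)))
                     X-fails (raise-threshold k₂ (k₁ - + 1) (fibre-threshold k₁ k₂ hk))

    projection-powerful′ : ∀ (k₁ k₂ : ℤ) (δ₂ : ℕ) → (∀ b → δ₂ ℕ.≤ deg (adj G₂) b) →
                           k₁ - + δ₂ ≤ k → k₁ ℤ.+ k₂ - + 1 ≤ k →
                           PAF (adj G₂) k₂ (projection (flip R)) → PowerfulAlliance (adj G₁) k₁ X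
    projection-powerful′ k₁ k₂ δ₂ mindeg hk₁ hk paf₂ =
      (projection-nonempty , X-defensive) , (projection-nonempty , projection-offensive {k₁} δ₂ mindeg hk₁)
      where
      X-defensive : ∀ a → a ∈ X → + degIn (adj G₁) (∁ X) a ℤ.+ k₁ ≤ + degIn (adj G₁) X a
      X-defensive a a∈X with + degIn (adj G₁) (∁ X) a ℤ.+ k₁ ℤP.≤? + degIn (adj G₁) X a
      ... | yes holds = holds
      ... | no fails  = ⊥-elim (paf₂ (fibre R a) (column⊆projection (flip R) a)
                                  (fibre-powerful {k₁} {k₂} (proj₂ (∈-projection⁻ R a∈X)) (ℤP.≰⇒> fails) hk))

open Coordinates using (ProductAlliance; ProductInequality)

-- A powerful k-alliance Y of G₁ × G₂ is a powerful k-alliance in coordinates: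
-- by the product degree formula the alliance inequalities at (a , b) are the
-- coordinatewise ones, and row and column neighbours are product neighbours.
product-alliance : ∀ G₁ G₂ {k} (Y : Subset (n G₁ ℕ.* n G₂)) →
                   PowerfulAlliance (prodAdj G₁ G₂) k Y → ProductAlliance G₁ G₂ (coords G₁ G₂ Y) k
product-alliance G₁ G₂ {k} Y ((Y-nonempty , Y-defensive) , (_ , Y-offensive)) = record
  { nonempty  = nonempty
  ; defensive = λ a b aYb → inequality-at k a b (Y-defensive (combine a b) (true⇒∈ aYb))
  ; offensive = λ a b aYb-false attacked →
      inequality-at (k ℤ.+ + 2) a b (Y-offensive (combine a b) ((λ ab∈Y → not-¬ (∈⇒true ab∈Y) aYb-false) , neighbour a b attacked))
  }
  where
  open Coordinates G₁ G₂ (coords G₁ G₂ Y) using (Attacked)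

  nonempty : ∃ λ a → ∃ λ b → coords G₁ G₂ Y a b ≡ true
  nonempty =
    let (x , x∈Y) = Y-nonempty
        (a , b) = remQuot {n G₁} (n G₂) x
    in a , b , trans (cong (lookup Y) (combine-remQuot {n G₁} (n G₂) x)) (∈⇒true x∈Y)

  inequality-at : ∀ K a b → + degIn (prodAdj G₁ G₂) (∁ Y) (combine a b) ℤ.+ K ≤ + degIn (prodAdj G₁ G₂) Y (combine a b) →
                  ProductInequality G₁ G₂ (coords G₁ G₂ Y) K a b
  inequality-at K a b = subst₂ (λ out in′ → + out ℤ.+ K ≤ + in′) (degIn-prod-∁ G₁ G₂ Y a b) (degIn-prod G₁ G₂ Y a b)

  neighbour : ∀ a b → Attacked a b → ∃ λ u → u ∈ Y × prodAdj G₁ G₂ u (combine a b) ≡ true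
  neighbour a b (inj₁ (d , aYd , d∼b)) = combine a d , true⇒∈ aYd , row-edge G₁ G₂ a d∼b
  neighbour a b (inj₂ (c , cYb , c∼a)) = combine c b , true⇒∈ cYb , column-edge G₁ G₂ b c∼a

swap-alliance : ∀ {G₁ G₂ R k} → ProductAlliance G₁ G₂ R k → ProductAlliance G₂ G₁ (flip R) k
swap-alliance {G₁} {G₂} {R} {k} Y = record
  { nonempty  = let (a , b , aRb) = nonempty in b , a , aRb
  ; defensive = λ b a aRb → swap-inequality k (defensive a b aRb)
  ; offensive = λ b a aRb-false attacked → swap-inequality (k ℤ.+ + 2) (offensive a b aRb-false (swap-attack attacked))
  }
  where
  open ProductAlliance Y
  open Coordinates G₁ G₂ R using (Attacked; inRow; outRow; inColumn; outColumn)

  swap-inequality : ∀ K {a b} → ProductInequality G₁ G₂ R K a b → ProductInequality G₂ G₁ (flip R) K b a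
  swap-inequality K {a} {b} = subst₂ (λ out in′ → + out ℤ.+ K ≤ + in′)
    (ℕP.+-comm (outRow a b) (outColumn a b)) (ℕP.+-comm (inRow a b) (inColumn a b))

  swap-attack : ∀ {a b} → Coordinates.Attacked G₂ G₁ (flip R) b a → Attacked a b
  swap-attack (inj₁ neighbour) = inj₂ neighbour
  swap-attack (inj₂ neighbour) = inj₁ neighbour

PAF-⊆ : ∀ {m} {A : Adj m} {k} {P Q : Subset m} → P ⊆ Q → PAF A k Q → PAF A k P
PAF-⊆ P⊆Q paf Z Z⊆P = paf Z (P⊆Q ∘ Z⊆P)

projection₁-mono : ∀ G₁ G₂ {Y S : Subset (n G₁ ℕ.* n G₂)} → Y ⊆ S → projection (coords G₁ G₂ Y) ⊆ proj₁S G₁ G₂ S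
projection₁-mono G₁ G₂ {Y} {S} Y⊆S =
  projection-mono {R = coords G₁ G₂ Y} {coords G₁ G₂ S} (λ a b → ∈⇒true ∘ Y⊆S ∘ true⇒∈)

projection₂-mono : ∀ G₁ G₂ {Y S : Subset (n G₁ ℕ.* n G₂)} → Y ⊆ S →
                   projection (flip (coords G₁ G₂ Y)) ⊆ proj₂S G₁ G₂ S
projection₂-mono G₁ G₂ {Y} {S} Y⊆S =
  projection-mono {R = flip (coords G₁ G₂ Y)} {flip (coords G₁ G₂ S)} (λ b a → ∈⇒true ∘ Y⊆S ∘ true⇒∈)

open Coordinates using (projection-powerful; projection-powerful′)

-- Part (i): a powerful k-alliance Y ⊆ S would project to a powerful
-- k₁-alliance inside P_{V₁}(S) (resp. k₂-alliance inside P_{V₂}(S)).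
paf-by-projection₁ : ∀ G₁ G₂ {Δ₂ k₁ k} (S : Subset (n G₁ ℕ.* n G₂)) → (∀ b → deg (adj G₂) b ℕ.≤ Δ₂) →
                     PAF (adj G₁) k₁ (proj₁S G₁ G₂ S) → k₁ ℤ.+ + Δ₂ ≤ k → PAF (prodAdj G₁ G₂) k S
paf-by-projection₁ G₁ G₂ {Δ₂} {k₁} S maxdeg₂ paf₁ hk Y Y⊆S Y-powerful =
  paf₁ _ (projection₁-mono G₁ G₂ Y⊆S)
    (projection-powerful G₁ G₂ (coords G₁ G₂ Y) (product-alliance G₁ G₂ Y Y-powerful) k₁ Δ₂ maxdeg₂ hk)

paf-by-projection₂ : ∀ G₁ G₂ {Δ₁ k₂ k} (S : Subset (n G₁ ℕ.* n G₂)) → (∀ a → deg (adj G₁) a ℕ.≤ Δ₁) →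
                     PAF (adj G₂) k₂ (proj₂S G₁ G₂ S) → k₂ ℤ.+ + Δ₁ ≤ k → PAF (prodAdj G₁ G₂) k S
paf-by-projection₂ G₁ G₂ {Δ₁} {k₂} S maxdeg₁ paf₂ hk Y Y⊆S Y-powerful =
  paf₂ _ (projection₂-mono G₁ G₂ Y⊆S)
    (projection-powerful G₂ G₁ (flip (coords G₁ G₂ Y)) (swap-alliance (product-alliance G₁ G₂ Y Y-powerful)) k₂ Δ₁ maxdeg₁ hk)

-- Part (ii), in the two cases of the minimum: the projection on the factor
-- named by the minimum would be a powerful alliance, because the other
-- projection is paf.
paf-by-both-projections₁ : ∀ G₁ G₂ {δ₂ k₁ k₂ k} (S : Subset (n G₁ ℕ.* n G₂)) → (∀ b → δ₂ ℕ.≤ deg (adj G₂) b) →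
  PAF (adj G₁) k₁ (proj₁S G₁ G₂ S) → PAF (adj G₂) k₂ (proj₂S G₁ G₂ S) →
  k₁ - + δ₂ ≤ k → k₁ ℤ.+ k₂ - + 1 ≤ k → PAF (prodAdj G₁ G₂) k S
paf-by-both-projections₁ G₁ G₂ {δ₂} {k₁} {k₂} S mindeg₂ paf₁ paf₂ hk₁ hk Y Y⊆S Y-powerful =
  paf₁ _ (projection₁-mono G₁ G₂ Y⊆S)
    (projection-powerful′ G₁ G₂ (coords G₁ G₂ Y) (product-alliance G₁ G₂ Y Y-powerful) k₁ k₂ δ₂ mindeg₂ hk₁ hk
      (PAF-⊆ {k = k₂} (projection₂-mono G₁ G₂ Y⊆S) paf₂))

paf-by-both-projections₂ : ∀ G₁ G₂ {δ₁ k₁ k₂ k} (S : Subset (n G₁ ℕ.* n G₂)) → (∀ a → δ₁ ℕ.≤ deg (adj G₁) a) →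
  PAF (adj G₁) k₁ (proj₁S G₁ G₂ S) → PAF (adj G₂) k₂ (proj₂S G₁ G₂ S) →
  k₂ - + δ₁ ≤ k → k₂ ℤ.+ k₁ - + 1 ≤ k → PAF (prodAdj G₁ G₂) k S
paf-by-both-projections₂ G₁ G₂ {δ₁} {k₁} {k₂} S mindeg₁ paf₁ paf₂ hk₂ hk Y Y⊆S Y-powerful =
  paf₂ _ (projection₂-mono G₁ G₂ Y⊆S)
    (projection-powerful′ G₂ G₁ (flip (coords G₁ G₂ Y)) (swap-alliance (product-alliance G₁ G₂ Y Y-powerful))
                          k₂ k₁ δ₁ mindeg₁ hk₂ hk
      (PAF-⊆ {k = k₁} (projection₁-mono G₁ G₂ Y⊆S) paf₁))

⊓-bounded : ∀ {x y k : ℤ} → x ⊓ y ≤ k → x ≤ k ⊎ y ≤ k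
⊓-bounded {x} {y} x⊓y≤k with ℤP.⊓-sel x y
... | inj₁ x⊓y≡x = inj₁ (subst (_≤ _) x⊓y≡x x⊓y≤k)
... | inj₂ x⊓y≡y = inj₂ (subst (_≤ _) x⊓y≡y x⊓y≤k)

-- The theorem.  The upper bound k ≤ Δ₁ + Δ₂ - 2 only delimits the range of
-- the statement; the argument does not need it.
theorem14 : (G₁ G₂ : SimpleGraph) (Δ₁ Δ₂ δ₁ δ₂ : ℕ)
    → IsMaxDegree G₁ Δ₁ → IsMaxDegree G₂ Δ₂
    → IsMinDegree G₁ δ₁ → IsMinDegree G₂ δ₂
    → (S : Subset (n G₁ ℕ.* n G₂))
    → ((k₁ : ℤ) → PAF (adj G₁) k₁ (proj₁S G₁ G₂ S)
    → ∀ k → k₁ ℤ.+ + Δ₂ ≤ k → k ≤ + Δ₁ ℤ.+ + Δ₂ - + 2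
    → PAF (prodAdj G₁ G₂) k S)
    × ((k₂ : ℤ) → PAF (adj G₂) k₂ (proj₂S G₁ G₂ S)
    → ∀ k → k₂ ℤ.+ + Δ₁ ≤ k → k ≤ + Δ₁ ℤ.+ + Δ₂ - + 2
    → PAF (prodAdj G₁ G₂) k S)
    × ((k₁ k₂ : ℤ) → PAF (adj G₁) k₁ (proj₁S G₁ G₂ S) → PAF (adj G₂) k₂ (proj₂S G₁ G₂ S)
    → ∀ k → ((k₁ ℤ.+ k₂ - + 1) ⊔ ((k₂ - + δ₁) ⊓ (k₁ - + δ₂))) ≤ k
    → k ≤ + Δ₁ ℤ.+ + Δ₂ - + 2
    → PAF (prodAdj G₁ G₂) k S)
theorem14 G₁ G₂ Δ₁ Δ₂ δ₁ δ₂ (maxdeg₁ , _) (maxdeg₂ , _) (mindeg₁ , _) (mindeg₂ , _) S =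
  (λ k₁ paf₁ k hk _ → paf-by-projection₁ G₁ G₂ {k₁ = k₁} S maxdeg₂ paf₁ hk) ,
  (λ k₂ paf₂ k hk _ → paf-by-projection₂ G₁ G₂ {k₂ = k₂} S maxdeg₁ paf₂ hk) ,
  part-ii
  where
  part-ii : (k₁ k₂ : ℤ) → PAF (adj G₁) k₁ (proj₁S G₁ G₂ S) → PAF (adj G₂) k₂ (proj₂S G₁ G₂ S)
    → ∀ k → ((k₁ ℤ.+ k₂ - + 1) ⊔ ((k₂ - + δ₁) ⊓ (k₁ - + δ₂))) ≤ k → k ≤ + Δ₁ ℤ.+ + Δ₂ - + 2
    → PAF (prodAdj G₁ G₂) k S
  part-ii k₁ k₂ paf₁ paf₂ k bound _
    with k₁+k₂-1≤k ← ℤP.i⊔j≤k⇒i≤k (k₁ ℤ.+ k₂ - + 1) _ bound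
       | ⊓-bounded (ℤP.i⊔j≤k⇒j≤k (k₁ ℤ.+ k₂ - + 1) _ bound)
  ... | inj₁ k₂-δ₁≤k = paf-by-both-projections₂ G₁ G₂ {k₁ = k₁} {k₂} S mindeg₁ paf₁ paf₂ k₂-δ₁≤k
                         (subst (λ s → s - + 1 ≤ k) (ℤP.+-comm k₁ k₂) k₁+k₂-1≤k)
  ... | inj₂ k₁-δ₂≤k = paf-by-both-projections₁ G₁ G₂ {k₁ = k₁} {k₂} S mindeg₂ paf₁ paf₂ k₁-δ₂≤k k₁+k₂-1≤k
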